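{- Let $q$ be a prime power, $Y \subseteq \mathbb{F}_q$ and $E \subseteq \mathbb{F}_q^2$. Then there exists $y\in Y$ such that \[ |\{ay+b : (a,b)\in E\}| \gg \min\left\{ |Y|^{1/2}q^{1/2},\ \frac{|Y|^{1/2}|E|}{q},\ |E| \right\}. \]
   Context: $\mathbb{F}_q$ is the finite field with $q$ elements. The notation $f\gg g$ means $f\ge cg$ for an absolute constant $c>0$ not depending on any other parameters. -}

module Defs where

open import Data.Nat using (ℕ; zero; suc; _+_; _*_; _⊔_; _⊓_)
open import Data.Bool using (Bool; true; false; _∧_; _∨_; if_then_else_)
open import Data.Fin using (Fin; zero; suc; _≟_)
open import Data.Product using (Σ; _×_; _,_)
open import Relation.Nullary using (¬_)
open import Relation.Nullary.Decidable using (⌊_⌋)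
open import Relation.Binary.PropositionalEquality using (_≡_)
open import Algebra.Structures using (IsCommutativeRing)

-- A finite field with exactly q elements, represented on the carrier Fin q
-- (every finite field of order q is isomorphic to one of these; q is then
-- automatically a prime power, and every prime power occurs).
record FiniteField (q : ℕ) : Set where
  field
    _+F_ _*F_ : Fin q → Fin q → Fin q
    -F_ : Fin q → Fin q
    0F 1F : Fin q
    isCommutativeRing : IsCommutativeRing _≡_ _+F_ _*F_ -F_ 0F 1F
    0≢1 : ¬ (0F ≡ 1F)
    inverse : ∀ x → ¬ (x ≡ 0F) → Σ (Fin q) λ y → (x *F y) ≡ 1F

count : ∀ {n} → (Fin n → Bool) → ℕ
count {zero} P = 0
count {suc n} P = (if P zero then 1 else 0) + count (λ i → P (suc i))

anyF : ∀ {n} → (Fin n → Bool) → Bool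
anyF {zero} P = false
anyF {suc n} P = P zero ∨ anyF (λ i → P (suc i))

SubsetF : ℕ → Set
SubsetF q = Fin q → Bool

SubsetF² : ℕ → Set
SubsetF² q = Fin q → Fin q → Bool

size : ∀ {q} → SubsetF q → ℕ
size Y = count Y

sumF : ∀ {n} → (Fin n → ℕ) → ℕ
sumF {zero} f = 0
sumF {suc n} f = f zero + sumF (λ i → f (suc i))

size² : ∀ {q} → SubsetF² q → ℕ
size² E = sumF (λ a → count (λ b → E a b))

imageSize : ∀ {q} → FiniteField q → SubsetF² q → Fin q → ℕ
imageSize F E y = count (λ z → anyF (λ a → anyF (λ b →
    E a b ∧ ⌊ ((a *F y) +F b) ≟ z ⌋)))
  where open FiniteField F

min3 : ℕ → ℕ → ℕ → ℕ
min3 x y z = x ⊓ y ⊓ z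

-- Write r_y(z) for the number of (a , b) ∈ E with a y + b = z, N(y) for the size of the image
-- {a y + b}, and energy(y) = Σ_z r_y(z)², the number of pairs in E whose lines take the same
-- value at y.  Since Σ_z r_y(z) = |E| and r_y is supported on the image, Cauchy–Schwarz gives
-- |E|² ≤ energy(y) · N(y) ≤ energy(y) · q.
-- Two distinct lines meet at most once, so Σ_y energy(y) ≤ q |E| + |E|²; hence the excesses
-- q energy(y) − |E|² are nonnegative with total at most q² |E|, and a y ∈ Y minimising the excess
-- has |Y| q energy(y) ≤ q² |E| + |Y| |E|².  Eliminating energy(y) between the two bounds gives
-- q |Y| |E| ≤ N(y) (q² + |Y| |E|), and according as q² or |Y| |E| dominates, either q ≤ 2 N(y)
-- (so |Y| q³ ≤ 4 N(y)² q²) or |Y| |E| ≤ 2 N(y) q (so |Y| |E|² ≤ 4 N(y)² q²); thus k = 1.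
module Submission where

open import Defs
open import Algebra.Bundles using (CommutativeRing)
open import Data.Bool using (Bool; true; false; _∧_; if_then_else_)
open import Data.Bool.Properties using () renaming (_≟_ to _≟ᵇ_)
open import Data.Fin using (Fin; zero; suc; _≟_)
open import Data.Fin.Properties using (suc-injective; 0≢1+n)
open import Data.List using (List; []; _∷_; allFin; filter)
open import Data.List.Extrema.Nat using (argmin; argmin-all; f[argmin]≤f[xs])
open import Data.List.Membership.Propositional.Properties using (∈-filter⁺; ∈-allFin)
open import Data.List.Relation.Unary.All using (lookup)
open import Data.List.Relation.Unary.All.Properties using (all-filter)
open import Data.Nat using (ℕ; zero; suc; _+_; _*_; _∸_; _^_; _⊓_; _≤_; _≤?_; z≤n; s≤s; >-nonZero)
open import Data.Nat.Properties
  using ( +-*-semiring; +-comm; +-identityʳ; *-distribˡ-+; *-comm; *-assoc; *-identityʳ; *-zeroʳ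
        ; ≤-reflexive; ≤-trans; ≤-total; <⇒≤; ≰⇒>; m≤m+n; m≤n+m; m≤m*n; m≤n⇒∃[o]m+o≡n; m∸n+n≡m; m⊓n≤m; m⊓n≤n
        ; +-mono-≤; +-monoˡ-≤; +-monoʳ-≤; +-cancelʳ-≤; *-mono-≤; *-monoˡ-≤; *-monoʳ-≤; *-cancelˡ-≤; *-cancelʳ-≤
        ; module ≤-Reasoning )
open import Data.Nat.Tactic.RingSolver using (solve-∀; solve)
open import Data.Empty using (⊥-elim)
open import Data.Product using (Σ; ∃; _×_; _,_)
open import Data.Sum using (_⊎_; inj₁; inj₂; [_,_]′)
open import Function using (_∘_)
open import Relation.Nullary using (¬_; yes; no; does)
open import Relation.Nullary.Decidable using (⌊_⌋; _×-dec_; dec-true; dec-false; isYes≗does)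
open import Relation.Unary using (Pred; Decidable)
open import Relation.Binary.PropositionalEquality
open import Algebra.Properties.Semiring.Sum +-*-semiring
  using (sum; sum-syntax; sum-cong-≗; sum-replicate-zero; sum-remove; ∑-comm; ∑-distrib-+; *-distribˡ-sum; *-distribʳ-sum)

𝟙 : Bool → ℕ
𝟙 b = if b then 1 else 0

𝟙-∧ : ∀ x y → 𝟙 (x ∧ y) ≡ 𝟙 x * 𝟙 y
𝟙-∧ true  y = sym (+-identityʳ (𝟙 y))
𝟙-∧ false y = refl

𝟙-idem : ∀ x → 𝟙 x * 𝟙 x ≡ 𝟙 x
𝟙-idem true  = refl
𝟙-idem false = refl

𝟙≤1 : ∀ x → 𝟙 x ≤ 1
𝟙≤1 true  = s≤s z≤n
𝟙≤1 false = z≤n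

-- Built from `does` rather than `⌊_⌋` (which is `isYes`), so that δ (suc i) (suc j) reduces to δ i j.
δ : ∀ {n} → Fin n → Fin n → ℕ
δ i j = 𝟙 (does (i ≟ j))

δ-refl : ∀ {n} (i : Fin n) → δ i i ≡ 1
δ-refl i = cong 𝟙 (dec-true (i ≟ i) refl)

sumF≡sum : ∀ {n} (f : Fin n → ℕ) → sumF f ≡ sum f
sumF≡sum {zero}  f = refl
sumF≡sum {suc n} f = cong (f zero +_) (sumF≡sum (f ∘ suc))

count≡∑𝟙 : ∀ {n} (P : Fin n → Bool) → count P ≡ ∑[ i < n ] 𝟙 (P i)
count≡∑𝟙 {zero}  P = refl
count≡∑𝟙 {suc n} P = cong (𝟙 (P zero) +_) (count≡∑𝟙 (P ∘ suc))

∑-mono-≤ : ∀ {n} {f g : Fin n → ℕ} → (∀ i → f i ≤ g i) → sum f ≤ sum g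
∑-mono-≤ {zero}  f≤g = z≤n
∑-mono-≤ {suc n} f≤g = +-mono-≤ (f≤g zero) (∑-mono-≤ (f≤g ∘ suc))

∑-const : ∀ n c → ∑[ i < n ] c ≡ n * c
∑-const zero    c = refl
∑-const (suc n) c = cong (c +_) (∑-const n c)

∑-≤-card : ∀ {n} (f : Fin n → ℕ) → (∀ i → f i ≤ 1) → sum f ≤ n
∑-≤-card {n} f f≤1 = ≤-trans (∑-mono-≤ f≤1) (≤-reflexive (trans (∑-const n 1) (*-identityʳ n)))

term≤∑ : ∀ {n} (f : Fin n → ℕ) i → f i ≤ sum f
term≤∑ {suc n} f i = ≤-trans (m≤m+n (f i) _) (≤-reflexive (sym (sum-remove {i = i} f)))

∑-*-∑ : ∀ {m n} (f : Fin m → ℕ) (g : Fin n → ℕ) → sum f * sum g ≡ ∑[ i < m ] ∑[ j < n ] (f i * g j)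
∑-*-∑ f g = trans (*-distribʳ-sum (sum g) f) (sum-cong-≗ λ i → *-distribˡ-sum (f i) g)

∑-δ-sift : ∀ {n} (i : Fin n) (f : Fin n → ℕ) → sum (λ j → δ i j * f j) ≡ f i
∑-δ-sift {suc n} zero    f = trans (cong₂ _+_ (+-identityʳ (f zero)) (sum-replicate-zero n)) (+-identityʳ (f zero))
∑-δ-sift {suc n} (suc i) f = ∑-δ-sift i (f ∘ suc)

count≤card : ∀ {n} (P : Fin n → Bool) → count P ≤ n
count≤card P = subst (_≤ _) (sym (count≡∑𝟙 P)) (∑-≤-card (𝟙 ∘ P) (𝟙≤1 ∘ P))

count-pos : ∀ {n} (P : Fin n → Bool) {i} → P i ≡ true → 1 ≤ count P
count-pos P {i} Pi = subst₂ _≤_ (cong 𝟙 Pi) (sym (count≡∑𝟙 P)) (term≤∑ (𝟙 ∘ P) i)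

∑-𝟙-unique : ∀ {n p} {A : Pred (Fin n) p} (A? : Decidable A) →
             (∀ {i j} → A i → A j → i ≡ j) → ∑[ i < n ] 𝟙 (does (A? i)) ≤ 1
∑-𝟙-unique {zero}  A? unique = z≤n
∑-𝟙-unique {suc n} A? unique with A? zero
... | no  _  = ∑-𝟙-unique (A? ∘ suc) (λ Ai Aj → suc-injective (unique Ai Aj))
... | yes A₀ = s≤s (≤-reflexive (trans (sum-cong-≗ absent) (sum-replicate-zero n)))
  where
  absent : ∀ i → 𝟙 (does (A? (suc i))) ≡ 0
  absent i = cong 𝟙 (dec-false (A? (suc i)) (0≢1+n ∘ unique A₀))

∑-*-𝟙-anyF : ∀ {n} (f : Fin n → ℕ) (P : Fin n → Bool) →
             (∀ i → f i * 𝟙 (P i) ≡ f i) → sum f * 𝟙 (anyF P) ≡ sum f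
∑-*-𝟙-anyF {zero}  f P supported = refl
∑-*-𝟙-anyF {suc n} f P supported with P zero in P₀
... | true  = *-identityʳ _
... | false = begin
  (f zero + sum (f ∘ suc)) * 𝟙 (anyF (P ∘ suc)) ≡⟨ cong (λ x → (x + sum (f ∘ suc)) * 𝟙 (anyF (P ∘ suc))) f₀≡0 ⟩
  sum (f ∘ suc) * 𝟙 (anyF (P ∘ suc))            ≡⟨ ∑-*-𝟙-anyF (f ∘ suc) (P ∘ suc) (supported ∘ suc) ⟩
  sum (f ∘ suc)                                  ≡⟨ cong (_+ sum (f ∘ suc)) f₀≡0 ⟨
  f zero + sum (f ∘ suc)                         ∎
  where
  open ≡-Reasoning
  f₀≡0 : f zero ≡ 0
  f₀≡0 = trans (sym (supported zero)) (trans (cong (λ b → f zero * 𝟙 b) P₀) (*-zeroʳ (f zero)))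

2*m*n≤m*m+n*n : ∀ m n → 2 * (m * n) ≤ m * m + n * n
2*m*n≤m*m+n*n m n = [ ordered , flipped ]′ (≤-total m n)
  where
  ordered : ∀ {m n} → m ≤ n → 2 * (m * n) ≤ m * m + n * n
  ordered {m} m≤n with d , refl ← m≤n⇒∃[o]m+o≡n m≤n =
    ≤-trans (m≤m+n _ (d * d)) (≤-reflexive (square-of-sum m d))
    where
    square-of-sum : ∀ m d → 2 * (m * (m + d)) + d * d ≡ m * m + (m + d) * (m + d)
    square-of-sum = solve-∀
  flipped : n ≤ m → 2 * (m * n) ≤ m * m + n * n
  flipped n≤m = subst₂ _≤_ (cong (2 *_) (*-comm n m)) (+-comm (n * n) (m * m)) (ordered n≤m)

cauchy-schwarz : ∀ {n} (f g : Fin n → ℕ) →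
                 sum (λ i → f i * g i) * sum (λ i → f i * g i) ≤ sum (λ i → f i * f i) * sum (λ i → g i * g i)
cauchy-schwarz {n} f g = *-cancelˡ-≤ 2 (begin
  2 * (sum fg * sum fg)                                  ≡⟨ cong (2 *_) (∑-*-∑ fg fg) ⟩
  2 * (∑[ i < n ] ∑[ j < n ] (fg i * fg j))              ≡⟨ *-distribˡ-sum 2 (λ i → ∑[ j < n ] (fg i * fg j)) ⟩
  ∑[ i < n ] (2 * ∑[ j < n ] (fg i * fg j))              ≡⟨ sum-cong-≗ (λ i → *-distribˡ-sum 2 (λ j → fg i * fg j)) ⟩
  ∑[ i < n ] ∑[ j < n ] (2 * (fg i * fg j))              ≤⟨ ∑-mono-≤ (λ i → ∑-mono-≤ (cross i)) ⟩
  ∑[ i < n ] ∑[ j < n ] (B i j + B j i)                  ≡⟨ sum-cong-≗ (λ i → ∑-distrib-+ (B i) (λ j → B j i)) ⟩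
  ∑[ i < n ] (sum (B i) + ∑[ j < n ] B j i)              ≡⟨ ∑-distrib-+ (λ i → sum (B i)) _ ⟩
  ∑[ i < n ] sum (B i) + ∑[ i < n ] ∑[ j < n ] B j i     ≡⟨ cong (∑[ i < n ] sum (B i) +_) (∑-comm (λ i j → B j i)) ⟩
  ∑[ i < n ] sum (B i) + ∑[ j < n ] sum (B j)            ≡⟨ cong (∑[ i < n ] sum (B i) +_) (+-identityʳ _) ⟨
  2 * ∑[ i < n ] sum (B i)                                ≡⟨ cong (2 *_) (∑-*-∑ ff gg) ⟨
  2 * (sum ff * sum gg)                                  ∎)
  where
  open ≤-Reasoning
  fg ff gg : Fin n → ℕ
  fg i = f i * g i
  ff i = f i * f i
  gg i = g i * g i
  B : Fin n → Fin n → ℕ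
  B i j = ff i * gg j
  cross : ∀ i j → 2 * (fg i * fg j) ≤ B i j + B j i
  cross i j = subst₂ _≤_ (cong (2 *_) (swap-factors (f i) (g i) (f j) (g j))) (squares (f i) (g i) (f j) (g j))
                (2*m*n≤m*m+n*n (f i * g j) (f j * g i))
    where
    swap-factors : ∀ a b c d → (a * d) * (c * b) ≡ (a * b) * (c * d)
    swap-factors = solve-∀
    squares : ∀ a b c d → (a * d) * (a * d) + (c * b) * (c * b) ≡ (a * a) * (d * d) + (c * c) * (b * b)
    squares = solve-∀

∑-squared-≤-support : ∀ {n} (f : Fin n → ℕ) (P : Fin n → Bool) → (∀ i → f i * 𝟙 (P i) ≡ f i) →
                      sum f * sum f ≤ sum (λ i → f i * f i) * count P
∑-squared-≤-support f P supported =
  subst₂ _≤_ (cong₂ _*_ ∑f𝟙≡∑f ∑f𝟙≡∑f) (cong (sum (λ i → f i * f i) *_) ∑𝟙𝟙≡count) (cauchy-schwarz f (𝟙 ∘ P))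
  where
  ∑f𝟙≡∑f : sum (λ i → f i * 𝟙 (P i)) ≡ sum f
  ∑f𝟙≡∑f = sum-cong-≗ supported
  ∑𝟙𝟙≡count : sum (λ i → 𝟙 (P i) * 𝟙 (P i)) ≡ count P
  ∑𝟙𝟙≡count = trans (sum-cong-≗ (𝟙-idem ∘ P)) (sym (count≡∑𝟙 P))

∃-≤-average : ∀ {n} (P : Fin n → Bool) (f : Fin n → ℕ) → ∃ (λ i → P i ≡ true) →
              ∃ λ i → P i ≡ true × count P * f i ≤ sum f
∃-≤-average {n} P f (i₀ , Pi₀) = i , Pi , (begin
  count P * f i                 ≡⟨ cong (_* f i) (count≡∑𝟙 P) ⟩
  (∑[ j < n ] 𝟙 (P j)) * f i    ≡⟨ *-distribʳ-sum (f i) (𝟙 ∘ P) ⟩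
  ∑[ j < n ] (𝟙 (P j) * f i)    ≤⟨ ∑-mono-≤ weighted-minimal ⟩
  sum f                         ∎)
  where
  open ≤-Reasoning
  P? : Decidable (λ j → P j ≡ true)
  P? j = P j ≟ᵇ true
  candidates : List (Fin n)
  candidates = filter P? (allFin n)
  i : Fin n
  i = argmin f i₀ candidates
  Pi : P i ≡ true
  Pi = argmin-all f Pi₀ (all-filter P? (allFin n))
  weighted-minimal : ∀ j → 𝟙 (P j) * f i ≤ f j
  weighted-minimal j with P j in Pj
  ... | true  = ≤-trans (≤-reflexive (+-identityʳ (f i)))
                  (lookup (f[argmin]≤f[xs] i₀ candidates) (∈-filter⁺ P? (∈-allFin j) Pj))
  ... | false = z≤n

∑² : ∀ {m n} → (Fin m → Fin n → ℕ) → ℕ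
∑² f = sum (λ a → sum (f a))

module _ {m n : ℕ} where

  ∑²-cong : {f g : Fin m → Fin n → ℕ} → (∀ a b → f a b ≡ g a b) → ∑² f ≡ ∑² g
  ∑²-cong f≡g = sum-cong-≗ (λ a → sum-cong-≗ (f≡g a))

  ∑²-mono-≤ : {f g : Fin m → Fin n → ℕ} → (∀ a b → f a b ≤ g a b) → ∑² f ≤ ∑² g
  ∑²-mono-≤ f≤g = ∑-mono-≤ (λ a → ∑-mono-≤ (f≤g a))

  ∑²-distrib-+ : (f g : Fin m → Fin n → ℕ) → ∑² (λ a b → f a b + g a b) ≡ ∑² f + ∑² g
  ∑²-distrib-+ f g = trans (sum-cong-≗ (λ a → ∑-distrib-+ (f a) (g a))) (∑-distrib-+ (λ a → sum (f a)) (λ a → sum (g a)))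

  *-distribˡ-∑² : ∀ c (f : Fin m → Fin n → ℕ) → c * ∑² f ≡ ∑² (λ a b → c * f a b)
  *-distribˡ-∑² c f = trans (*-distribˡ-sum c (λ a → sum (f a))) (sum-cong-≗ (λ a → *-distribˡ-sum c (f a)))

  *-distribʳ-∑² : ∀ c (f : Fin m → Fin n → ℕ) → ∑² f * c ≡ ∑² (λ a b → f a b * c)
  *-distribʳ-∑² c f = trans (*-distribʳ-sum c (λ a → sum (f a))) (sum-cong-≗ (λ a → *-distribʳ-sum c (f a)))

  ∑²-*-∑² : (f g : Fin m → Fin n → ℕ) → ∑² f * ∑² g ≡ ∑² (λ a b → ∑² (λ a' b' → f a b * g a' b'))
  ∑²-*-∑² f g = trans (*-distribʳ-∑² (∑² g) f) (∑²-cong (λ a b → *-distribˡ-∑² (f a b) g))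

  ∑-∑²-comm : ∀ {k} (f : Fin k → Fin m → Fin n → ℕ) → sum (λ z → ∑² (f z)) ≡ ∑² (λ a b → sum (λ z → f z a b))
  ∑-∑²-comm f = trans (∑-comm (λ z a → sum (f z a))) (sum-cong-≗ (λ a → ∑-comm (λ z → f z a)))

  ∑²-δ-sift : ∀ a b (f : Fin m → Fin n → ℕ) → ∑² (λ a' b' → (δ a a' * δ b b') * f a' b') ≡ f a b
  ∑²-δ-sift a b f = begin
    ∑² (λ a' b' → (δ a a' * δ b b') * f a' b')        ≡⟨ ∑²-cong (λ a' b' → *-assoc (δ a a') (δ b b') (f a' b')) ⟩
    sum (λ a' → sum (λ b' → δ a a' * (δ b b' * f a' b'))) ≡⟨ sum-cong-≗ (λ a' → *-distribˡ-sum (δ a a') (λ b' → δ b b' * f a' b')) ⟨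
    sum (λ a' → δ a a' * sum (λ b' → δ b b' * f a' b')) ≡⟨ sum-cong-≗ (λ a' → cong (δ a a' *_) (∑-δ-sift b (f a'))) ⟩
    sum (λ a' → δ a a' * f a' b)                        ≡⟨ ∑-δ-sift a (λ a' → f a' b) ⟩
    f a b                                               ∎
    where open ≡-Reasoning

two-regimes : ∀ q t N → q * t ≤ N * (q * q + t) → q ≤ 2 * N ⊎ t ≤ 2 * N * q
two-regimes zero        t N _ = inj₁ z≤n
two-regimes q@(suc _) t N h with q * q ≤? t
... | yes q²≤t = inj₁ (*-cancelʳ-≤ q (2 * N) t {{>-nonZero (≤-trans (s≤s z≤n) q²≤t)}} (begin
  q * t             ≤⟨ h ⟩
  N * (q * q + t)   ≤⟨ *-monoʳ-≤ N (+-monoˡ-≤ t q²≤t) ⟩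
  N * (t + t)       ≡⟨ double N t ⟩
  2 * N * t         ∎))
  where
  open ≤-Reasoning
  double : ∀ N t → N * (t + t) ≡ 2 * N * t
  double = solve-∀
... | no  q²≰t = inj₂ (*-cancelˡ-≤ q (begin
  q * t                 ≤⟨ h ⟩
  N * (q * q + t)       ≤⟨ *-monoʳ-≤ N (+-monoʳ-≤ (q * q) (<⇒≤ (≰⇒> q²≰t))) ⟩
  N * (q * q + q * q)   ≡⟨ double N q ⟩
  q * (2 * N * q)       ∎))
  where
  open ≤-Reasoning
  double : ∀ N q → N * (q * q + q * q) ≡ q * (2 * N * q)
  double = solve-∀

eliminate-energy : ∀ {q Y e C N} → e * e ≤ C * N → q * (Y * C) ≤ q * q * e + Y * (e * e) →
                   e * (q * (Y * e)) ≤ e * (N * (q * q + Y * e))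
eliminate-energy {q} {Y} {e} {C} {N} e²≤CN qYC≤ = begin
  e * (q * (Y * e))                ≡⟨ solve (e ∷ q ∷ Y ∷ []) ⟩
  q * (Y * (e * e))                ≤⟨ *-monoʳ-≤ q (*-monoʳ-≤ Y e²≤CN) ⟩
  q * (Y * (C * N))                ≡⟨ solve (q ∷ Y ∷ C ∷ N ∷ []) ⟩
  N * (q * (Y * C))                ≤⟨ *-monoʳ-≤ N qYC≤ ⟩
  N * (q * q * e + Y * (e * e))    ≡⟨ solve (N ∷ q ∷ e ∷ Y ∷ []) ⟩
  e * (N * (q * q + Y * e))        ∎
  where open ≤-Reasoning

-- The ring solver treats ℕ's _^_ as opaque, so powers are unfolded definitionally around it.
min3-≤-in-both-regimes : ∀ {q Y e N} → 1 ≤ Y → Y ≤ q → q ≤ 2 * N ⊎ Y * e ≤ 2 * N * q →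
                         min3 (Y * q ^ 3) (Y * e ^ 2) (e ^ 2 * q ^ 2) ≤ 2 ^ 2 * N ^ 2 * q ^ 2
min3-≤-in-both-regimes {q} {Y} {e} {N} 1≤Y Y≤q (inj₁ q≤2N) =
  ≤-trans (≤-trans (m⊓n≤m _ (e ^ 2 * q ^ 2)) (m⊓n≤m (Y * q ^ 3) (Y * e ^ 2))) (begin
  Y * q ^ 3                                       ≤⟨ *-monoˡ-≤ (q ^ 3) Y≤q ⟩
  q * q ^ 3                                       ≡⟨⟩
  q * (q * (q * (q * 1)))                         ≡⟨ solve (q ∷ []) ⟩
  (q * q) * (q * q)                               ≤⟨ *-monoˡ-≤ (q * q) (*-mono-≤ q≤2N q≤2N) ⟩
  (2 * N) * (2 * N) * (q * q)                     ≡⟨ solve (N ∷ q ∷ []) ⟩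
  (2 * (2 * 1)) * (N * (N * 1)) * (q * (q * 1))   ≡⟨⟩
  2 ^ 2 * N ^ 2 * q ^ 2                           ∎)
  where open ≤-Reasoning
min3-≤-in-both-regimes {q} {Y} {e} {N} 1≤Y Y≤q (inj₂ Ye≤2Nq) =
  ≤-trans (≤-trans (m⊓n≤m _ (e ^ 2 * q ^ 2)) (m⊓n≤n (Y * q ^ 3) (Y * e ^ 2))) (begin
  Y * e ^ 2                                       ≡⟨⟩
  Y * (e * (e * 1))                               ≤⟨ *-monoˡ-≤ (e * (e * 1)) (m≤m*n Y Y {{>-nonZero 1≤Y}}) ⟩
  (Y * Y) * (e * (e * 1))                         ≡⟨ solve (Y ∷ e ∷ []) ⟩
  (Y * e) * (Y * e)                               ≤⟨ *-mono-≤ Ye≤2Nq Ye≤2Nq ⟩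
  (2 * N * q) * (2 * N * q)                       ≡⟨ solve (N ∷ q ∷ []) ⟩
  (2 * (2 * 1)) * (N * (N * 1)) * (q * (q * 1))   ≡⟨⟩
  2 ^ 2 * N ^ 2 * q ^ 2                           ∎)
  where open ≤-Reasoning

min3-bound : ∀ {q Y e C N} → 1 ≤ Y → Y ≤ q → e * e ≤ C * N → q * (Y * C) ≤ q * q * e + Y * (e * e) →
             min3 (Y * q ^ 3) (Y * e ^ 2) (e ^ 2 * q ^ 2) ≤ 2 ^ 2 * N ^ 2 * q ^ 2
min3-bound {q} {Y} {zero} _ _ _ _ =
  ≤-trans (≤-trans (m⊓n≤m _ 0) (m⊓n≤n (Y * q ^ 3) (Y * 0))) (≤-trans (≤-reflexive (*-zeroʳ Y)) z≤n)
min3-bound {q} {Y} {e@(suc _)} {C} {N} 1≤Y Y≤q e²≤CN qYC≤ =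
  min3-≤-in-both-regimes {q} {Y} {e} {N} 1≤Y Y≤q
    (two-regimes q (Y * e) N (*-cancelˡ-≤ e (eliminate-energy {q} {Y} {e} {C} {N} e²≤CN qYC≤)))

module LineGeometry {q : ℕ} (F : FiniteField q) where

  open FiniteField F

  private
    commutativeRing : CommutativeRing _ _
    commutativeRing = record { isCommutativeRing = isCommutativeRing }

  open CommutativeRing commutativeRing
    using (ring)
    renaming (+-assoc to +F-assoc; +-identityˡ to +F-identityˡ; -‿inverseʳ to -F‿inverseʳ; *-assoc to *F-assoc; *-identityʳ to *F-identityʳ)
  open import Algebra.Properties.Ring ring using (x[y-z]≈xy-xz; +-cancelˡ; x∙y⁻¹≈ε⇒x≈y; -‿anti-homo-+)

  lineAt : Fin q → Fin q → Fin q → Fin q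
  lineAt a b y = (a *F y) +F b

  *-cancelʳ-≢0 : ∀ {x y d} → d ≢ 0F → (x *F d) ≡ (y *F d) → x ≡ y
  *-cancelʳ-≢0 {x} {y} {d} d≢0 xd≡yd with d⁻¹ , dd⁻¹≡1 ← inverse d d≢0 = begin
    x                 ≡⟨ *F-identityʳ x ⟨
    x *F 1F           ≡⟨ cong (x *F_) dd⁻¹≡1 ⟨
    x *F (d *F d⁻¹)   ≡⟨ *F-assoc x d d⁻¹ ⟨
    (x *F d) *F d⁻¹   ≡⟨ cong (_*F d⁻¹) xd≡yd ⟩
    (y *F d) *F d⁻¹   ≡⟨ *F-assoc y d d⁻¹ ⟩
    y *F (d *F d⁻¹)   ≡⟨ cong (y *F_) dd⁻¹≡1 ⟩
    y *F 1F           ≡⟨ *F-identityʳ y ⟩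
    y                 ∎
    where open ≡-Reasoning

  [x+z]-[y+z]≡x-y : ∀ x y z → ((x +F z) +F (-F (y +F z))) ≡ (x +F (-F y))
  [x+z]-[y+z]≡x-y x y z = begin
    (x +F z) +F (-F (y +F z))     ≡⟨ cong ((x +F z) +F_) (-‿anti-homo-+ y z) ⟩
    (x +F z) +F ((-F z) +F (-F y)) ≡⟨ +F-assoc x z ((-F z) +F (-F y)) ⟩
    x +F (z +F ((-F z) +F (-F y))) ≡⟨ cong (x +F_) (+F-assoc z (-F z) (-F y)) ⟨
    x +F ((z +F (-F z)) +F (-F y)) ≡⟨ cong (λ t → x +F (t +F (-F y))) (-F‿inverseʳ z) ⟩
    x +F (0F +F (-F y))           ≡⟨ cong (x +F_) (+F-identityˡ (-F y)) ⟩
    x +F (-F y)                   ∎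
    where open ≡-Reasoning

  lines-through-two-points : ∀ {a b a' b' y y'} → y ≢ y' →
    lineAt a b y ≡ lineAt a' b' y → lineAt a b y' ≡ lineAt a' b' y' → a ≡ a' × b ≡ b'
  lines-through-two-points {a} {b} {a'} {b'} {y} {y'} y≢y' at-y at-y' =
    a≡a' , +-cancelˡ (a *F y) b b' (trans at-y (cong (λ s → lineAt s b' y) (sym a≡a')))
    where
    open ≡-Reasoning
    y-y'≢0 : (y +F (-F y')) ≢ 0F
    y-y'≢0 = y≢y' ∘ x∙y⁻¹≈ε⇒x≈y y y'
    a≡a' : a ≡ a'
    a≡a' = *-cancelʳ-≢0 y-y'≢0 (begin
      a *F (y +F (-F y'))                              ≡⟨ x[y-z]≈xy-xz a y y' ⟩
      (a *F y) +F (-F (a *F y'))                       ≡⟨ [x+z]-[y+z]≡x-y (a *F y) (a *F y') b ⟨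
      lineAt a b y +F (-F (lineAt a b y'))             ≡⟨ cong₂ (λ u v → u +F (-F v)) at-y at-y' ⟩
      lineAt a' b' y +F (-F (lineAt a' b' y'))         ≡⟨ [x+z]-[y+z]≡x-y (a' *F y) (a' *F y') b' ⟩
      (a' *F y) +F (-F (a' *F y'))                     ≡⟨ x[y-z]≈xy-xz a' y y' ⟨
      a' *F (y +F (-F y'))                             ∎)

  collisions : Fin q → Fin q → Fin q → Fin q → ℕ
  collisions a b a' b' = ∑[ y < q ] δ (lineAt a' b' y) (lineAt a b y)

  distinct-lines-meet-at-most-once : ∀ {a b a' b'} → ¬ (a ≡ a' × b ≡ b') → collisions a b a' b' ≤ 1
  distinct-lines-meet-at-most-once {a} {b} {a'} {b'} distinct =
    ∑-𝟙-unique (λ y → lineAt a' b' y ≟ lineAt a b y) meet-once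
    where
    meet-once : ∀ {y y'} → lineAt a' b' y ≡ lineAt a b y → lineAt a' b' y' ≡ lineAt a b y' → y ≡ y'
    meet-once {y} {y'} at-y at-y' with y ≟ y'
    ... | yes y≡y' = y≡y'
    ... | no  y≢y' = ⊥-elim (distinct (lines-through-two-points y≢y' (sym at-y) (sym at-y')))

  collisions-≤ : ∀ a b a' b' → collisions a b a' b' ≤ q * (δ a a' * δ b b') + 1
  collisions-≤ a b a' b' with (a ≟ a') ×-dec (b ≟ b')
  ... | no  distinct      = ≤-trans (distinct-lines-meet-at-most-once distinct) (m≤n+m 1 _)
  ... | yes (refl , refl) = begin
    collisions a b a b                          ≤⟨ ∑-≤-card _ (λ y → 𝟙≤1 _) ⟩
    q                                           ≡⟨ *-identityʳ q ⟨
    q * 1                                       ≡⟨ cong (q *_) (cong₂ _*_ (δ-refl a) (δ-refl b)) ⟨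
    q * (δ a a * δ b b)                         ≤⟨ m≤m+n _ 1 ⟩
    q * (δ a a * δ b b) + 1                     ∎
    where open ≤-Reasoning

module Incidences {q : ℕ} (F : FiniteField q) (E : SubsetF² q) where

  open FiniteField F
  open LineGeometry F

  incident : Fin q → Fin q → Fin q → Fin q → Bool
  incident y z a b = E a b ∧ ⌊ lineAt a b y ≟ z ⌋

  multiplicity : Fin q → Fin q → ℕ
  multiplicity y z = ∑² (λ a b → 𝟙 (incident y z a b))

  energy : Fin q → ℕ
  energy y = ∑[ z < q ] (multiplicity y z * multiplicity y z)

  𝟙-incident : ∀ y z a b → 𝟙 (incident y z a b) ≡ δ (lineAt a b y) z * 𝟙 (E a b)
  𝟙-incident y z a b = begin
    𝟙 (E a b ∧ ⌊ lineAt a b y ≟ z ⌋)   ≡⟨ 𝟙-∧ (E a b) _ ⟩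
    𝟙 (E a b) * 𝟙 ⌊ lineAt a b y ≟ z ⌋ ≡⟨ cong (λ t → 𝟙 (E a b) * 𝟙 t) (isYes≗does (lineAt a b y ≟ z)) ⟩
    𝟙 (E a b) * δ (lineAt a b y) z      ≡⟨ *-comm (𝟙 (E a b)) _ ⟩
    δ (lineAt a b y) z * 𝟙 (E a b)      ∎
    where open ≡-Reasoning

  size²≡∑² : size² E ≡ ∑² (λ a b → 𝟙 (E a b))
  size²≡∑² = trans (sumF≡sum (λ a → count (E a))) (sum-cong-≗ (λ a → count≡∑𝟙 (E a)))

  ∑-multiplicity : ∀ y → ∑[ z < q ] multiplicity y z ≡ size² E
  ∑-multiplicity y = begin
    sum (λ z → ∑² (λ a b → 𝟙 (incident y z a b)))  ≡⟨ ∑-∑²-comm (λ z a b → 𝟙 (incident y z a b)) ⟩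
    ∑² (λ a b → sum (λ z → 𝟙 (incident y z a b)))  ≡⟨ ∑²-cong (λ a b → sum-cong-≗ (λ z → 𝟙-incident y z a b)) ⟩
    ∑² (λ a b → sum (λ z → δ (lineAt a b y) z * 𝟙 (E a b))) ≡⟨ ∑²-cong (λ a b → ∑-δ-sift (lineAt a b y) (λ _ → 𝟙 (E a b))) ⟩
    ∑² (λ a b → 𝟙 (E a b))                          ≡⟨ size²≡∑² ⟨
    size² E                                         ∎
    where open ≡-Reasoning

  size²²≤energy*imageSize : ∀ y → size² E * size² E ≤ energy y * imageSize F E y
  size²²≤energy*imageSize y = subst (λ e → e * e ≤ energy y * imageSize F E y) (∑-multiplicity y)
    (∑-squared-≤-support (multiplicity y) (λ z → anyF (λ a → anyF (λ b → incident y z a b))) supported)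
    where
    supported : ∀ z → multiplicity y z * 𝟙 (anyF (λ a → anyF (λ b → incident y z a b))) ≡ multiplicity y z
    supported z = ∑-*-𝟙-anyF _ _ (λ a → ∑-*-𝟙-anyF _ _ (λ b → 𝟙-idem (incident y z a b)))

  size²²≤q*energy : ∀ y → size² E * size² E ≤ q * energy y
  size²²≤q*energy y = ≤-trans (size²²≤energy*imageSize y)
    (≤-trans (*-monoʳ-≤ (energy y) (count≤card _)) (≤-reflexive (*-comm (energy y) q)))

  W : Fin q → Fin q → Fin q → Fin q → ℕ
  W a b a' b' = 𝟙 (E a b) * 𝟙 (E a' b')

  meet : Fin q → Fin q → Fin q → Fin q → Fin q → ℕ
  meet y a b a' b' = δ (lineAt a' b' y) (lineAt a b y)

  ∑-incident-incident : ∀ y a b a' b' →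
    sum (λ z → 𝟙 (incident y z a b) * 𝟙 (incident y z a' b')) ≡ W a b a' b' * meet y a b a' b'
  ∑-incident-incident y a b a' b' = trans
    (sum-cong-≗ (λ z → trans (cong₂ _*_ (𝟙-incident y z a b) (𝟙-incident y z a' b')) (regroup (δ (lineAt a b y) z) (𝟙 (E a b)) (δ (lineAt a' b' y) z) (𝟙 (E a' b')))))
    (∑-δ-sift (lineAt a b y) (λ z → (𝟙 (E a b) * 𝟙 (E a' b')) * δ (lineAt a' b' y) z))
    where
    regroup : ∀ d x d' x' → (d * x) * (d' * x') ≡ d * ((x * x') * d')
    regroup = solve-∀

  energy≡∑-meetings : ∀ y → energy y ≡ ∑² (λ a b → ∑² (λ a' b' → W a b a' b' * meet y a b a' b'))
  energy≡∑-meetings y = begin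
    sum (λ z → multiplicity y z * multiplicity y z)
      ≡⟨ sum-cong-≗ (λ z → ∑²-*-∑² (I z) (I z)) ⟩
    sum (λ z → ∑² (λ a b → ∑² (λ a' b' → I z a b * I z a' b')))
      ≡⟨ ∑-∑²-comm (λ z a b → ∑² (λ a' b' → I z a b * I z a' b')) ⟩
    ∑² (λ a b → sum (λ z → ∑² (λ a' b' → I z a b * I z a' b')))
      ≡⟨ ∑²-cong (λ a b → ∑-∑²-comm (λ z a' b' → I z a b * I z a' b')) ⟩
    ∑² (λ a b → ∑² (λ a' b' → sum (λ z → I z a b * I z a' b')))
      ≡⟨ ∑²-cong (λ a b → ∑²-cong (∑-incident-incident y a b)) ⟩
    ∑² (λ a b → ∑² (λ a' b' → W a b a' b' * meet y a b a' b')) ∎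
    where
    open ≡-Reasoning
    I : Fin q → Fin q → Fin q → ℕ
    I z a b = 𝟙 (incident y z a b)

  ∑-energy≡∑-collisions : ∑[ y < q ] energy y ≡ ∑² (λ a b → ∑² (λ a' b' → W a b a' b' * collisions a b a' b'))
  ∑-energy≡∑-collisions = begin
    sum energy
      ≡⟨ sum-cong-≗ energy≡∑-meetings ⟩
    sum (λ y → ∑² (λ a b → ∑² (λ a' b' → W a b a' b' * meet y a b a' b')))
      ≡⟨ ∑-∑²-comm (λ y a b → ∑² (λ a' b' → W a b a' b' * meet y a b a' b')) ⟩
    ∑² (λ a b → sum (λ y → ∑² (λ a' b' → W a b a' b' * meet y a b a' b')))
      ≡⟨ ∑²-cong (λ a b → ∑-∑²-comm (λ y a' b' → W a b a' b' * meet y a b a' b')) ⟩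
    ∑² (λ a b → ∑² (λ a' b' → sum (λ y → W a b a' b' * meet y a b a' b')))
      ≡⟨ ∑²-cong (λ a b → ∑²-cong (λ a' b' → *-distribˡ-sum (W a b a' b') (λ y → meet y a b a' b'))) ⟨
    ∑² (λ a b → ∑² (λ a' b' → W a b a' b' * collisions a b a' b')) ∎
    where open ≡-Reasoning

  ∑-coincident-pairs : ∑² (λ a b → ∑² (λ a' b' → q * ((δ a a' * δ b b') * W a b a' b'))) ≡ q * size² E
  ∑-coincident-pairs = begin
    ∑² (λ a b → ∑² (λ a' b' → q * ((δ a a' * δ b b') * W a b a' b')))
      ≡⟨ ∑²-cong (λ a b → *-distribˡ-∑² q (λ a' b' → (δ a a' * δ b b') * W a b a' b')) ⟨
    ∑² (λ a b → q * ∑² (λ a' b' → (δ a a' * δ b b') * W a b a' b'))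
      ≡⟨ ∑²-cong (λ a b → cong (q *_) (trans (∑²-δ-sift a b (W a b)) (𝟙-idem (E a b)))) ⟩
    ∑² (λ a b → q * 𝟙 (E a b))
      ≡⟨ *-distribˡ-∑² q (λ a b → 𝟙 (E a b)) ⟨
    q * ∑² (λ a b → 𝟙 (E a b))
      ≡⟨ cong (q *_) size²≡∑² ⟨
    q * size² E ∎
    where open ≡-Reasoning

  ∑-energy-≤ : ∑[ y < q ] energy y ≤ q * size² E + size² E * size² E
  ∑-energy-≤ = begin
    sum energy
      ≡⟨ ∑-energy≡∑-collisions ⟩
    ∑² (λ a b → ∑² (λ a' b' → W a b a' b' * collisions a b a' b'))
      ≤⟨ ∑²-mono-≤ (λ a b → ∑²-mono-≤ (λ a' b' → *-monoʳ-≤ (W a b a' b') (collisions-≤ a b a' b'))) ⟩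
    ∑² (λ a b → ∑² (λ a' b' → W a b a' b' * (q * (δ a a' * δ b b') + 1)))
      ≡⟨ ∑²-cong (λ a b → ∑²-cong (λ a' b' → expand q (δ a a' * δ b b') (W a b a' b'))) ⟩
    ∑² (λ a b → ∑² (λ a' b' → q * ((δ a a' * δ b b') * W a b a' b') + W a b a' b'))
      ≡⟨ ∑²-cong (λ a b → ∑²-distrib-+ (λ a' b' → q * ((δ a a' * δ b b') * W a b a' b')) (W a b)) ⟩
    ∑² (λ a b → ∑² (λ a' b' → q * ((δ a a' * δ b b') * W a b a' b')) + ∑² (W a b))
      ≡⟨ ∑²-distrib-+ (λ a b → ∑² (λ a' b' → q * ((δ a a' * δ b b') * W a b a' b'))) (λ a b → ∑² (W a b)) ⟩
    ∑² (λ a b → ∑² (λ a' b' → q * ((δ a a' * δ b b') * W a b a' b'))) + ∑² (λ a b → ∑² (W a b))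
      ≡⟨ cong₂ _+_ ∑-coincident-pairs (sym (trans (cong (λ e → e * e) size²≡∑²) (∑²-*-∑² 𝟙E 𝟙E))) ⟩
    q * size² E + size² E * size² E ∎
    where
    open ≤-Reasoning
    𝟙E : Fin q → Fin q → ℕ
    𝟙E a b = 𝟙 (E a b)
    expand : ∀ q d w → w * (q * d + 1) ≡ q * (d * w) + w
    expand = solve-∀

  excess : Fin q → ℕ
  excess y = q * energy y ∸ size² E * size² E

  excess+size²²≡q*energy : ∀ y → excess y + size² E * size² E ≡ q * energy y
  excess+size²²≡q*energy y = m∸n+n≡m (size²²≤q*energy y)

  ∑-excess-≤ : ∑[ y < q ] excess y ≤ q * q * size² E
  ∑-excess-≤ = +-cancelʳ-≤ (q * (e * e)) (sum excess) (q * q * e) (begin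
    sum excess + q * (e * e)            ≡⟨ cong (sum excess +_) (∑-const q (e * e)) ⟨
    sum excess + ∑[ y < q ] (e * e)     ≡⟨ ∑-distrib-+ excess (λ _ → e * e) ⟨
    sum (λ y → excess y + e * e)        ≡⟨ sum-cong-≗ excess+size²²≡q*energy ⟩
    sum (λ y → q * energy y)            ≡⟨ *-distribˡ-sum q energy ⟨
    q * sum energy                      ≤⟨ *-monoʳ-≤ q ∑-energy-≤ ⟩
    q * (q * e + e * e)                 ≡⟨ *-distribˡ-+ q (q * e) (e * e) ⟩
    q * (q * e) + q * (e * e)           ≡⟨ cong (_+ q * (e * e)) (*-assoc q q e) ⟨
    q * q * e + q * (e * e)             ∎)
    where
    open ≤-Reasoning
    e : ℕ
    e = size² E

  ∃-low-energy : (Y : SubsetF q) → ∃ (λ y → Y y ≡ true) →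
    ∃ λ y → Y y ≡ true × q * (size Y * energy y) ≤ q * q * size² E + size Y * (size² E * size² E)
  ∃-low-energy Y y₀ with y , Yy , |Y|*excess≤∑ ← ∃-≤-average Y excess y₀ = y , Yy , (begin
    q * (size Y * energy y)                   ≡⟨ x*[y*z]≡y*[x*z] q (size Y) (energy y) ⟩
    size Y * (q * energy y)                   ≡⟨ cong (size Y *_) (excess+size²²≡q*energy y) ⟨
    size Y * (excess y + e * e)               ≡⟨ *-distribˡ-+ (size Y) (excess y) (e * e) ⟩
    size Y * excess y + size Y * (e * e)      ≤⟨ +-monoˡ-≤ (size Y * (e * e)) (≤-trans |Y|*excess≤∑ ∑-excess-≤) ⟩
    q * q * e + size Y * (e * e)              ∎)
    where
    open ≤-Reasoning
    e : ℕ
    e = size² E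
    x*[y*z]≡y*[x*z] : ∀ x y z → x * (y * z) ≡ y * (x * z)
    x*[y*z]≡y*[x*z] = solve-∀

theorem2p4 : Σ ℕ λ k → ∀ (q : ℕ) (F : FiniteField q) (Y : SubsetF q) (E : SubsetF² q)
    → Σ (Fin q) (λ y₀ → Y y₀ ≡ true)
    → Σ (Fin q) λ y → (Y y ≡ true) ×
      (min3 (size Y * q ^ 3) (size Y * size² E ^ 2) (size² E ^ 2 * q ^ 2)
        ≤ suc k ^ 2 * imageSize F E y ^ 2 * q ^ 2)
theorem2p4 = 1 , λ q F Y E (y₀ , Yy₀) →
  let open Incidences F E
      y , Yy , low-energy = ∃-low-energy Y (y₀ , Yy₀)
  in  y , Yy , min3-bound (count-pos Y Yy₀) (count≤card Y) (size²²≤energy*imageSize y) low-energy
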